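{- There is a positive existential formula $\varphi(x,y,w)$ in the language $\{0,1,+,R\}$ such that for every prime $p$ and all $x,y,w\in\mathbb{N}$: $(\mathbb{N};0,1,+,\mid_p)\models\varphi(x,y,w)$ if and only if $(x,y,w)\in M_p$, where $M_p=\{(n,p^a,np^a)\colon n\geq0,\ a\geq0\}$.
   Context: For a prime $p$, $x\mid_p y$ means there exists $s\in\mathbb{Z}$ with $y=\pm xp^s$; in $(\mathbb{N};0,1,+,\mid_p)$ the binary symbol $R$ is interpreted as $\mid_p$ restricted to $\mathbb{N}$. -}

module Defs where

open import Data.Nat as ℕ using (ℕ; zero; suc)
open import Data.Integer as ℤ using (ℤ; +_; -[1+_])
open import Data.Fin using (Fin; zero; suc)
open import Data.Product using (Σ; _×_)
open import Data.Sum using (_⊎_)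
open import Relation.Binary.PropositionalEquality using (_≡_)

-- x ∣ₚ y  on ℤ:  ∃ s ∈ ℤ, y = ± x p^s.
-- For s = + a this is y = ± x p^a; for s = -(a+1) it is y = ± x / p^(a+1),
-- i.e. (clearing the denominator) y * p^(a+1) = ± x.
DivPExp : ℕ → ℤ → ℤ → ℤ → Set
DivPExp p x y (+ a)    = (y ≡ x ℤ.* (+ (p ℕ.^ a))) ⊎ (y ≡ ℤ.- (x ℤ.* (+ (p ℕ.^ a))))
DivPExp p x y -[1+ a ] = (y ℤ.* (+ (p ℕ.^ suc a)) ≡ x) ⊎ (y ℤ.* (+ (p ℕ.^ suc a)) ≡ ℤ.- x)

DivPℤ : ℕ → ℤ → ℤ → Set
DivPℤ p x y = Σ ℤ (λ s → DivPExp p x y s)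

DivP : ℕ → ℕ → ℕ → Set
DivP p x y = DivPℤ p (+ x) (+ y)

data Term (n : ℕ) : Set where
  var  : Fin n → Term n
  zer  : Term n
  one  : Term n
  plus : Term n → Term n → Term n

data PEFormula (n : ℕ) : Set where
  eqA  : Term n → Term n → PEFormula n
  relR : Term n → Term n → PEFormula n
  andF : PEFormula n → PEFormula n → PEFormula n
  orF  : PEFormula n → PEFormula n → PEFormula n
  exF  : PEFormula (suc n) → PEFormula n

Env : ℕ → Set
Env n = Fin n → ℕ

extend : {n : ℕ} → ℕ → Env n → Env (suc n)
extend v ρ zero    = v
extend v ρ (suc i) = ρ i

evalT : {n : ℕ} → Env n → Term n → ℕ
evalT ρ (var i)    = ρ i
evalT ρ zer        = 0
evalT ρ one        = 1
evalT ρ (plus s t) = evalT ρ s ℕ.+ evalT ρ t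

Sat : {n : ℕ} → ℕ → Env n → PEFormula n → Set
Sat p ρ (eqA s t)  = evalT ρ s ≡ evalT ρ t
Sat p ρ (relR s t) = DivP p (evalT ρ s) (evalT ρ t)
Sat p ρ (andF φ ψ) = Sat p ρ φ × Sat p ρ ψ
Sat p ρ (orF φ ψ)  = Sat p ρ φ ⊎ Sat p ρ ψ
Sat p ρ (exF φ)    = Σ ℕ (λ v → Sat p (extend v ρ) φ)

env3 : ℕ → ℕ → ℕ → Env 3
env3 x y w zero             = x
env3 x y w (suc zero)       = y
env3 x y w (suc (suc zero)) = w

InM : ℕ → ℕ → ℕ → ℕ → Set
InM p x y w = Σ ℕ (λ n → Σ ℕ (λ a → (x ≡ n) × (y ≡ p ℕ.^ a) × (w ≡ n ℕ.* p ℕ.^ a)))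

module Submission where

-- The formula is
--   φ(x, y, w)  :=  1 ∣ₚ y  ∧  x ∣ₚ w  ∧  (x+1) ∣ₚ (w+y)  ∧  (x+2) ∣ₚ (w+2y).
-- Soundness: for y = pᵃ and w = n·pᵃ every conjunct holds with exponent a.
-- Completeness: on ℕ, m ∣ₚ n only says that m and n agree up to powers of p,
-- i.e. m·pⁱ = n·pʲ for some i, j.  If p ∤ m this forces n = m·pᵇ.  The heart
-- of the argument is exponent rigidity: for p ∤ u,
--   (u+1)·pᴷ = u·pᴵ + pᴬ   implies   I = A.
-- Hence from u ∣ₚ v and (u+1) ∣ₚ (v + pᵃ) with p ∤ u we recover v = u·pᵃ.
-- The first conjunct gives y = pᵃ; since p cannot divide both x and x+1,
-- this transfer applies to (x, w) or to (x+1, w+y), and either yields w = x·pᵃ.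

open import Defs
open import Data.Nat using (ℕ)
open import Data.Nat.Primality using (Prime)
open import Data.Product using (Σ)
open import Function.Bundles using (_⇔_)

open import Data.Nat using (zero; suc; z<s; _+_; _*_; _^_; _<_; NonZero; NonTrivial; >-nonZero; nonTrivial⇒nonZero; nonTrivial⇒n>1; nonTrivial⇒≢1)
open import Data.Nat.Properties
open import Data.Nat.Divisibility using (_∣_; _∣?_; _∣0; ∣1⇒≡1; ∣m+n∣m⇒∣n; ∣n⇒∣m*n; m∣m*n)
open import Data.Nat.Primality using (prime⇒nonTrivial)
open import Data.Integer using (+_; -[1+_]; -_)
open import Data.Integer.Properties using (pos-*; +-injective)
open import Data.Fin using (Fin)
open import Data.Product using (_×_; _,_)
open import Data.Sum using (inj₁; inj₂)
open import Data.Empty using (⊥-elim)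
open import Relation.Nullary using (¬_; yes; no; contradiction)
open import Relation.Binary.PropositionalEquality
open import Function.Bundles using (mk⇔)

EqUpToPowers : ℕ → ℕ → ℕ → Set
EqUpToPowers p m n = Σ ℕ (λ i → Σ ℕ (λ j → m * p ^ i ≡ n * p ^ j))

scaled⇒divP : ∀ p {m n} a → m * p ^ a ≡ n → DivP p m n
scaled⇒divP p {m} a eq = + a , inj₁ (trans (cong +_ (sym eq)) (pos-* m (p ^ a)))

-- If a natural number equals the negative of another, both are zero;
-- this disposes of the negative-sign cases of ∣ₚ.
≡-neg⇒both-zero : ∀ a b → + a ≡ - (+ b) → (a ≡ 0) × (b ≡ 0)
≡-neg⇒both-zero zero zero _ = refl , refl

divP⇒eqUpToPowers : ∀ p {m n} → DivP p m n → EqUpToPowers p m n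
divP⇒eqUpToPowers p {m} {n} (+ a , inj₁ e) =
  a , 0 , trans (+-injective (trans (pos-* m (p ^ a)) (sym e))) (sym (*-identityʳ n))
divP⇒eqUpToPowers p {m} {n} (+ a , inj₂ e)
  with ≡-neg⇒both-zero n (m * p ^ a) (trans e (cong -_ (sym (pos-* m (p ^ a)))))
... | refl , m·pᵃ≡0 = a , 0 , m·pᵃ≡0
divP⇒eqUpToPowers p {m} {n} (-[1+ a ] , inj₁ e) =
  0 , suc a , trans (*-identityʳ m) (sym (+-injective (trans (pos-* n (p ^ suc a)) e)))
divP⇒eqUpToPowers p {m} {n} (-[1+ a ] , inj₂ e)
  with ≡-neg⇒both-zero (n * p ^ suc a) m (trans (pos-* n (p ^ suc a)) e)
... | n·pᵃ⁺¹≡0 , refl = 0 , suc a , sym n·pᵃ⁺¹≡0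

suc-* : ∀ m c → (m + 1) * c ≡ m * c + c
suc-* m c = trans (*-distribʳ-+ c m 1) (cong (λ t → m * c + t) (*-identityˡ c))

-- Completeness needs only p ≥ 2 (p nontrivial), not primality.
module NontrivialBase (p : ℕ) .{{_ : NonTrivial p}} where

  private
    instance
      p-nonZero : NonZero p
      p-nonZero = nonTrivial⇒nonZero p

  p∤1 : ¬ p ∣ 1
  p∤1 p∣1 = nonTrivial⇒≢1 {p} (∣1⇒≡1 p∣1)

  ∤⇒pos : ∀ {u} → ¬ p ∣ u → 0 < u
  ∤⇒pos {zero} p∤0 = ⊥-elim (p∤0 (p ∣0))
  ∤⇒pos {suc _} _ = z<s

  p∣*p^suc : ∀ m n → p ∣ m * p ^ suc n
  p∣*p^suc m n = ∣n⇒∣m*n m (m∣m*n (p ^ n))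

  <*p^suc : ∀ {m} n → 0 < m → m < m * p ^ suc n
  <*p^suc {m} n m>0 = m<m*n m (p ^ suc n) {{>-nonZero m>0}} 1<p^suc
    where
    1<p^suc : 1 < p ^ suc n
    1<p^suc = ≤-trans (nonTrivial⇒n>1 p) (m≤m*n p (p ^ n) {{m^n≢0 p n}})

  pull-p : ∀ m n → m * (p * n) ≡ p * (m * n)
  pull-p m n = trans (sym (*-assoc m p n)) (trans (cong (_* n) (*-comm m p)) (*-assoc p m n))

  cancel-p : ∀ m i n j → m * p ^ suc i ≡ n * p ^ suc j → m * p ^ i ≡ n * p ^ j
  cancel-p m i n j eq = *-cancelˡ-≡ _ _ p (trans (sym (pull-p m (p ^ i))) (trans eq (pull-p n (p ^ j))))

  coprime-scale : ∀ {m n} i j → ¬ p ∣ m → m * p ^ i ≡ n * p ^ j → Σ ℕ (λ b → n ≡ m * p ^ b)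
  coprime-scale {m} {n} i zero _ eq = i , trans (sym (*-identityʳ n)) (sym eq)
  coprime-scale {m} {n} zero (suc j) p∤m eq =
    ⊥-elim (p∤m (subst (p ∣_) (trans (sym eq) (*-identityʳ m)) (p∣*p^suc n j)))
  coprime-scale {m} {n} (suc i) (suc j) p∤m eq = coprime-scale i j p∤m (cancel-p m i n j eq)

  one-scale : ∀ {y} → EqUpToPowers p 1 y → Σ ℕ (λ a → y ≡ p ^ a)
  one-scale (i , j , eq) with coprime-scale i j p∤1 eq
  ... | a , y≡1·pᵃ = a , trans y≡1·pᵃ (*-identityˡ (p ^ a))

  -- Exponent rigidity.  After cancelling common factors p one of the exponents is 0;
  -- then either sizes do not match or reduction modulo p gives p ∣ u or p ∣ 1.
  rigidity : ∀ {u} K I A → ¬ p ∣ u → (u + 1) * p ^ K ≡ u * p ^ I + p ^ A → I ≡ A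
  rigidity zero zero zero _ _ = refl
  rigidity {u} zero zero (suc A) _ eq = contradiction 1≡pᴬ⁺¹ (<⇒≢ (<*p^suc A z<s))
    where
    1≡pᴬ⁺¹ : 1 ≡ 1 * p ^ suc A
    1≡pᴬ⁺¹ = +-cancelˡ-≡ u 1 _ (begin
      u + 1                ≡⟨ sym (*-identityʳ (u + 1)) ⟩
      (u + 1) * 1          ≡⟨ eq ⟩
      u * 1 + p ^ suc A    ≡⟨ cong₂ _+_ (*-identityʳ u) (sym (*-identityˡ _)) ⟩
      u + 1 * p ^ suc A    ∎)
      where open ≡-Reasoning
  rigidity {u} zero (suc I) A p∤u eq = contradiction eq (<⇒≢ lhs<rhs)
    where
    lhs<rhs : (u + 1) * 1 < u * p ^ suc I + p ^ A
    lhs<rhs = begin-strict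
      (u + 1) * 1          ≡⟨ *-identityʳ (u + 1) ⟩
      u + 1                ≡⟨ +-comm u 1 ⟩
      suc u                ≤⟨ <*p^suc I (∤⇒pos p∤u) ⟩
      u * p ^ suc I        <⟨ m<m+n _ (m^n>0 p A) ⟩
      u * p ^ suc I + p ^ A ∎
      where open ≤-Reasoning
  rigidity {u} (suc K) zero zero _ eq = contradiction (sym eq) (<⇒≢ rhs<lhs)
    where
    rhs<lhs : u * 1 + 1 < (u + 1) * p ^ suc K
    rhs<lhs = subst (_< (u + 1) * p ^ suc K) (cong (_+ 1) (sym (*-identityʳ u)))
                    (<*p^suc K (m≤n+m 1 u))
  rigidity {u} (suc K) zero (suc A) p∤u eq =
    ⊥-elim (p∤u (subst (p ∣_) (*-identityʳ u) (∣m+n∣m⇒∣n p∣pᴬ⁺¹+u (m∣m*n (p ^ A)))))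
    where
    p∣pᴬ⁺¹+u : p ∣ p ^ suc A + u * 1
    p∣pᴬ⁺¹+u = subst (p ∣_) (trans eq (+-comm (u * 1) _)) (p∣*p^suc (u + 1) K)
  rigidity {u} (suc K) (suc I) zero _ eq =
    ⊥-elim (p∤1 (∣m+n∣m⇒∣n (subst (p ∣_) eq (p∣*p^suc (u + 1) K)) (p∣*p^suc u I)))
  rigidity {u} (suc K) (suc I) (suc A) p∤u eq =
    cong suc (rigidity K I A p∤u (*-cancelˡ-≡ _ _ p (begin
      p * ((u + 1) * p ^ K)           ≡⟨ sym (pull-p (u + 1) (p ^ K)) ⟩
      (u + 1) * p ^ suc K             ≡⟨ eq ⟩
      u * p ^ suc I + p ^ suc A       ≡⟨ cong (_+ p ^ suc A) (pull-p u (p ^ I)) ⟩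
      p * (u * p ^ I) + p * p ^ A     ≡⟨ sym (*-distribˡ-+ p (u * p ^ I) (p ^ A)) ⟩
      p * (u * p ^ I + p ^ A)         ∎)))
    where open ≡-Reasoning

  transfer : ∀ {u v} a → ¬ p ∣ u → EqUpToPowers p u v →
             EqUpToPowers p (u + 1) (v + p ^ a) → v ≡ u * p ^ a
  transfer {u} {v} a p∤u (i , j , e₁) (k , l , e₂) with coprime-scale {n = v} i j p∤u e₁
  ... | b , refl = cong (λ c → u * p ^ c) (+-cancelʳ-≡ l b a (rigidity k (b + l) (a + l) p∤u sum-form))
    where
    open ≡-Reasoning
    sum-form : (u + 1) * p ^ k ≡ u * p ^ (b + l) + p ^ (a + l)
    sum-form = begin
      (u + 1) * p ^ k                   ≡⟨ e₂ ⟩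
      (u * p ^ b + p ^ a) * p ^ l       ≡⟨ *-distribʳ-+ (p ^ l) (u * p ^ b) (p ^ a) ⟩
      u * p ^ b * p ^ l + p ^ a * p ^ l ≡⟨ cong₂ _+_ (*-assoc u _ _) (sym (^-distribˡ-+-* p a l)) ⟩
      u * (p ^ b * p ^ l) + p ^ (a + l) ≡⟨ cong (λ t → u * t + p ^ (a + l)) (sym (^-distribˡ-+-* p b l)) ⟩
      u * p ^ (b + l) + p ^ (a + l)     ∎

  complete : ∀ x y w → DivP p 1 y → DivP p x w → DivP p (x + 1) (w + y) →
             DivP p (x + 1 + 1) (w + y + y) → InM p x y w
  complete x y w d₁ d₂ d₃ d₄ with one-scale {y} (divP⇒eqUpToPowers p d₁)
  ... | a , refl = x , a , refl , refl , w≡x·pᵃ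
    where
    w≡x·pᵃ : w ≡ x * p ^ a
    w≡x·pᵃ with p ∣? x
    ... | no p∤x = transfer a p∤x (divP⇒eqUpToPowers p d₂) (divP⇒eqUpToPowers p d₃)
    ... | yes p∣x = +-cancelʳ-≡ (p ^ a) w (x * p ^ a)
          (trans (transfer a p∤x+1 (divP⇒eqUpToPowers p d₃) (divP⇒eqUpToPowers p d₄))
                 (suc-* x (p ^ a)))
      where
      p∤x+1 : ¬ p ∣ x + 1
      p∤x+1 p∣x+1 = p∤1 (∣m+n∣m⇒∣n p∣x+1 p∣x)

sound : ∀ p x y w → InM p x y w →
        DivP p 1 y × DivP p x w × DivP p (x + 1) (w + y) × DivP p (x + 1 + 1) (w + y + y)
sound p _ _ _ (n , a , refl , refl , refl) =
  scaled⇒divP p a (*-identityˡ (p ^ a)) ,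
  scaled⇒divP p a refl ,
  scaled⇒divP p a (suc-* n (p ^ a)) ,
  scaled⇒divP p a (trans (suc-* (n + 1) (p ^ a)) (cong (_+ p ^ a) (suc-* n (p ^ a))))

φ : PEFormula 3
φ = andF (relR one Y) (andF (relR X W) (andF (relR (plus X one) (plus W Y))
      (relR (plus (plus X one) one) (plus (plus W Y) Y))))
  where
  X Y W : Term 3
  X = var Fin.zero
  Y = var (Fin.suc Fin.zero)
  W = var (Fin.suc (Fin.suc Fin.zero))

lemma4p7 : Σ (PEFormula 3) (λ φ → (p : ℕ) → Prime p → (x y w : ℕ) →
    Sat p (env3 x y w) φ ⇔ InM p x y w)
lemma4p7 = φ , λ p p-prime x y w →
  mk⇔ (λ (d₁ , d₂ , d₃ , d₄) →
         NontrivialBase.complete p {{prime⇒nonTrivial p-prime}} x y w d₁ d₂ d₃ d₄)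
      (sound p x y w)
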